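{- Let $n\ge 2$, $k\ge1$, and let $\alpha=(a_1,\dots,a_n)\in PP_n$ be complete; assume all cars follow the $k$-Naples parking rule. Then the following are equivalent: (i) $\alpha\in PF_{n,k}$; (ii) for every $j\in[n]$, spot $j$ is filled by a car whose preference is at least $j$; (iii) $\psi_k(c_j)\le a_j$ for all $j\in[n]$.
   Context: $[n]=\{1,\dots,n\}$, $PP_n=[n]^n$. Cars $c_1,\dots,c_n$ arrive in order at a one-way street with spots $1,\dots,n$; car $c_i$ has preference $a_i$. Under the $k$-Naples parking rule, car $c_i$ drives to spot $a_i$ and parks there if free; otherwise it checks spots $a_i-1,\dots,a_i-k$ (only those $\ge1$) in order and parks in the first free one; otherwise it drives forward and parks in the first free spot $j>a_i$, failing if none. $PF_{n,k}$: preferences for which all cars park. $\psi_k(c_j)$ is the spot where $c_j$ parks, or $\infty$ if it fails to park. $|\alpha|_i=|\{j:a_j=i\}|$, $u_\alpha(j)=\sum_{i=j}^n|\alpha|_i-(n-j+1)$, $U_\alpha=\{j\in[n]:u_\alpha(j)\ge1\}$. $\alpha$ is complete if $U_\alpha=\{2,3,\dots,n\}$. -}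

module Defs where

open import Data.Nat using (ℕ; zero; suc; _+_; _∸_; _≤_; _≟_)
open import Data.Bool using (Bool; true; false; if_then_else_; not)
open import Data.List using (List; []; _∷_; map; upTo)
open import Data.Nat.ListAction using (sum)
open import Data.Bool.ListAction using (any)
open import Data.Vec using (Vec; []; _∷_; lookup; count)
open import Data.Fin using (Fin)
open import Data.Maybe using (Maybe; just; nothing; maybe)
open import Data.Product using (Σ; _×_; _,_)
open import Data.Integer as ℤ using (ℤ; +_)
open import Relation.Nullary.Decidable using (⌊_⌋)
open import Relation.Binary.PropositionalEquality using (_≡_)
open import Function.Bundles using (_⇔_)

-- Spots are the naturals 1..n; an occupancy state is the list of taken spots.
Occ : Set
Occ = List ℕ

isFree : Occ → ℕ → Bool
isFree occ s = not (any (λ t → ⌊ t ≟ s ⌋) occ)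

backSearch : Occ → ℕ → ℕ → Maybe ℕ
backSearch occ s       zero    = nothing
backSearch occ zero    (suc d) = nothing
backSearch occ (suc s) (suc d) =
  if isFree occ (suc s) then just (suc s) else backSearch occ s d

fwdSearch : Occ → ℕ → ℕ → Maybe ℕ
fwdSearch occ j zero    = nothing
fwdSearch occ j (suc f) =
  if isFree occ j then just j else fwdSearch occ (suc j) f

parkOne : (n k : ℕ) → Occ → ℕ → Maybe ℕ
parkOne n k occ a =
  if isFree occ a then just a
  else (maybe just (fwdSearch occ (suc a) (n ∸ a)) (backSearch occ (a ∸ 1) k))

-- run all cars in order; result i = spot of car i (nothing = ∞, fails)
parkAll : (n k : ℕ) → Occ → {m : ℕ} → Vec ℕ m → Vec (Maybe ℕ) m
parkAll n k occ []       = []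
parkAll n k occ (a ∷ as) =
  parkOne n k occ a ∷ parkAll n k (maybe (_∷ occ) occ (parkOne n k occ a)) as

-- ψ_k(c_j), cars indexed by Fin n (car c_{j+1} is index j)
ψ : (n k : ℕ) → Vec ℕ n → Fin n → Maybe ℕ
ψ n k α j = lookup (parkAll n k [] α) j

IsPP : (n : ℕ) → Vec ℕ n → Set
IsPP n α = (j : Fin n) → 1 ≤ lookup α j × lookup α j ≤ n

IsPF : (n k : ℕ) → Vec ℕ n → Set
IsPF n k α = (j : Fin n) → Σ ℕ (λ s → ψ n k α j ≡ just s)

mult : {n : ℕ} → Vec ℕ n → ℕ → ℕ
mult α i = count (λ x → x ≟ i) α

u : (n : ℕ) → Vec ℕ n → ℕ → ℤ
u n α j = (+ sum (map (λ i → mult α (j + i)) (upTo (suc n ∸ j)))) ℤ.- (+ (suc n ∸ j))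

-- complete: U_α = {2,...,n}, i.e. for j ∈ [n], u_α(j) ≥ 1 iff j ≥ 2
IsComplete : (n : ℕ) → Vec ℕ n → Set
IsComplete n α = (j : ℕ) → 1 ≤ j → j ≤ n → ((+ 1 ℤ.≤ u n α j) ⇔ (2 ≤ j))

module Submission where

-- Completeness says that for 2 ≤ j ≤ n at most j − 2 cars prefer a spot below j.
--
-- As long as every car parks at or before its preference, no car ever moves past a
-- free spot, so whenever spot y + 1 is free, the cars so far that prefer spots ≤ y
-- are exactly the cars parked in [1, y].  Suppose a car with preference a nevertheless
-- drives forward to y + 1, and let z be the last free spot before it.  The backward
-- search from a skipped z, so z + k < a; later cars preferring more than z + k never
-- reach [1, z], and counting the cars that prefer spots ≤ y shows that those that
-- can reach [1, z] are too few to fill it.  So if all cars park, none overshoots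
-- its preference, which is (iii).  Counting parked cars against spots, all cars
-- park iff all n spots end up filled, so (i) with (iii) gives (ii), and (ii) gives (i).

open import Data.Bool using (true; false; if_then_else_)
open import Data.Empty using (⊥; ⊥-elim)
open import Data.Fin as Fin using (Fin; toℕ; fromℕ<)
open import Data.Fin.Properties using (toℕ-fromℕ<; toℕ<n)
open import Data.Integer as ℤ using (+≤+)
import Data.Integer.Properties as ℤ
open import Data.List using ([]; _∷_; applyUpTo; upTo; map)
open import Data.List.Properties using (map-upTo)
open import Data.Maybe using (Maybe; just; nothing; maybe)
open import Data.Maybe.Properties using (just-injective)
open import Data.Nat using (ℕ; zero; suc; _+_; _∸_; _≤_; _<_; _≮_; z≤n; s≤s; z<s)
open import Data.Nat.ListAction using (sum)
open import Data.Nat.Properties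
open import Algebra.Properties.CommutativeSemigroup +-commutativeSemigroup using (xy∙z≈y∙xz; xy∙z≈xz∙y)
open import Data.Product using (Σ; _×_; _,_; proj₁; proj₂)
open import Data.Sum using (_⊎_; inj₁; inj₂)
open import Data.Vec using (Vec; []; _∷_; lookup; count)
open import Data.Vec.Properties using (count≤n)
open import Data.Vec.Relation.Binary.Pointwise.Inductive as Pointwise using (Pointwise; []; _∷_)
open import Data.Vec.Relation.Unary.All using (All; []; _∷_)
open import Data.Vec.Relation.Unary.All.Properties using (lookup⁺; lookup⁻)
open import Function using (id; _∘_; _⇔_; mk⇔; Equivalence)
open import Relation.Binary.Definitions using (tri<; tri≈; tri>)
open import Relation.Binary.PropositionalEquality
open import Relation.Nullary using (¬_; yes; no; contradiction)
open import Relation.Nullary.Decidable using (dec-true; dec-false)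
open import Relation.Unary using (Pred; Decidable)

open import Defs

-- Occupancy

Free Taken : Occ → ℕ → Set
Free o p = isFree o p ≡ true
Taken o p = isFree o p ≡ false

free⇒¬taken : ∀ {b} → b ≡ true → b ≢ false
free⇒¬taken free taken with () ← trans (sym free) taken

isFree-∷-≢ : ∀ {t p} o → t ≢ p → isFree (t ∷ o) p ≡ isFree o p
isFree-∷-≢ {t} {p} o t≢p with t ≟ p
... | yes t≡p = contradiction t≡p t≢p
... | no _ = refl

taken-∷-self : ∀ {p} o → Taken (p ∷ o) p
taken-∷-self {p} o with p ≟ p
... | yes _ = refl
... | no p≢p = contradiction refl p≢p

taken-∷ : ∀ {t p} o → Taken o p → Taken (t ∷ o) p
taken-∷ {t} {p} o taken with t ≟ p
... | yes _ = refl
... | no _ = taken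

free-∷⁻ : ∀ {t p} o → Free (t ∷ o) p → Free o p
free-∷⁻ {t} {p} o free with t ≟ p
... | yes _ = contradiction free λ ()
... | no _ = free

taken-interval-suc : ∀ o {r s} → Taken o (suc s) → (∀ p → r < p → p ≤ s → Taken o p) →
                     ∀ p → r < p → p ≤ suc s → Taken o p
taken-interval-suc o taken-1+s taken-≤s p r<p p≤1+s with m≤n⇒m<n∨m≡n p≤1+s
... | inj₁ p<1+s = taken-≤s p r<p (≤-pred p<1+s)
... | inj₂ refl = taken-1+s

occupied : Occ → ℕ → ℕ
occupied o zero = zero
occupied o (suc y) = if isFree o (suc y) then occupied o y else suc (occupied o y)

occupied-[] : ∀ y → occupied [] y ≡ 0
occupied-[] zero = refl
occupied-[] (suc y) = occupied-[] y

occupied≤ : ∀ o y → occupied o y ≤ y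
occupied≤ o zero = z≤n
occupied≤ o (suc y) with isFree o (suc y)
... | true = m≤n⇒m≤1+n (occupied≤ o y)
... | false = s≤s (occupied≤ o y)

occupied-free : ∀ o y → Free o (suc y) → occupied o (suc y) ≡ occupied o y
occupied-free o y free rewrite free = refl

occupied-∷-> : ∀ {s} o y → y < s → occupied (s ∷ o) y ≡ occupied o y
occupied-∷-> o zero y<s = refl
occupied-∷-> {s} o (suc y) y<s
  rewrite isFree-∷-≢ o (>⇒≢ y<s) | occupied-∷-> o y (<-trans (n<1+n y) y<s) = refl

occupied-∷-≤ : ∀ {s} o y → occupied (s ∷ o) y ≤ suc (occupied o y)
occupied-∷-≤ o zero = z≤n
occupied-∷-≤ {s} o (suc y) with s ≟ suc y
... | yes refl rewrite occupied-∷-> {s} o y ≤-refl with isFree o s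
...   | true = ≤-refl
...   | false = n≤1+n _
occupied-∷-≤ {s} o (suc y) | no s≢1+y with isFree o (suc y)
...   | true = occupied-∷-≤ o y
...   | false = s≤s (occupied-∷-≤ o y)

occupied-∷-free : ∀ {s} o y → Free o s → 1 ≤ s → s ≤ y → occupied (s ∷ o) y ≡ suc (occupied o y)
occupied-∷-free o zero free (s≤s _) ()
occupied-∷-free {s} o (suc y) free 1≤s s≤1+y with s ≟ suc y
... | yes refl rewrite free = cong suc (occupied-∷-> o y ≤-refl)
... | no s≢1+y with isFree o (suc y)
...   | true = occupied-∷-free o y free 1≤s (≤-pred (≤∧≢⇒< s≤1+y s≢1+y))
...   | false = cong suc (occupied-∷-free o y free 1≤s (≤-pred (≤∧≢⇒< s≤1+y s≢1+y)))

occupied≡⇒taken : ∀ o y → occupied o y ≡ y → ∀ p → 1 ≤ p → p ≤ y → Taken o p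
occupied≡⇒taken o zero full (suc p) 1≤p ()
occupied≡⇒taken o (suc y) full p 1≤p p≤1+y with isFree o (suc y) in y-free
... | true = contradiction (subst (_≤ y) full (occupied≤ o y)) (n≮n y)
... | false with p ≟ suc y
...   | yes refl = y-free
...   | no p≢1+y = occupied≡⇒taken o y (suc-injective full) p 1≤p (≤-pred (≤∧≢⇒< p≤1+y p≢1+y))

taken⇒occupied≡ : ∀ o y → (∀ p → 1 ≤ p → p ≤ y → Taken o p) → occupied o y ≡ y
taken⇒occupied≡ o zero taken = refl
taken⇒occupied≡ o (suc y) taken rewrite taken (suc y) (s≤s z≤n) ≤-refl =
  cong suc (taken⇒occupied≡ o y (λ p 1≤p p≤y → taken p 1≤p (m≤n⇒m≤1+n p≤y)))

-- z is the last free spot in [1, y], or 0 if there is none; the identity says that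
-- every spot in (z, y] is taken, without truncated subtraction.
lastFree : ∀ o y → Σ ℕ λ z → z ≤ y × (z ≡ 0 ⊎ (1 ≤ z × Free o z)) × occupied o y + z ≡ y + occupied o z
lastFree o zero = 0 , z≤n , inj₁ refl , refl
lastFree o (suc y) with isFree o (suc y) in y-free
... | true = suc y , ≤-refl , inj₂ (s≤s z≤n , y-free) ,
  trans (+-comm (occupied o y) (suc y)) (cong (suc y +_) (sym (occupied-free o y y-free)))
... | false with z , z≤y , z-free , eq ← lastFree o y = z , m≤n⇒m≤1+n z≤y , z-free , cong suc eq

-- Counting preferences

module _ {a ℓ} {A : Set a} {P : Pred A ℓ} (P? : Decidable P) where

  count-∷-yes : ∀ {m x} (xs : Vec A m) → P x → count P? (x ∷ xs) ≡ suc (count P? xs)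
  count-∷-yes {x = x} xs px = cong (λ b → (if b then suc else id) (count P? xs)) (dec-true (P? x) px)

  count-∷-no : ∀ {m x} (xs : Vec A m) → ¬ P x → count P? (x ∷ xs) ≡ count P? xs
  count-∷-no {x = x} xs ¬px = cong (λ b → (if b then suc else id) (count P? xs)) (dec-false (P? x) ¬px)

below : ∀ {m} → Vec ℕ m → ℕ → ℕ
below as j = count (_<? j) as

below-∷-< : ∀ {m a j} (as : Vec ℕ m) → a < j → below (a ∷ as) j ≡ suc (below as j)
below-∷-< {j = j} = count-∷-yes (_<? j)

below-∷-≮ : ∀ {m a j} (as : Vec ℕ m) → a ≮ j → below (a ∷ as) j ≡ below as j
below-∷-≮ {j = j} = count-∷-no (_<? j)

below≤below-∷ : ∀ {m} a (as : Vec ℕ m) j → below as j ≤ below (a ∷ as) j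
below≤below-∷ a as j with a <? j
... | yes a<j = subst (below as j ≤_) (sym (below-∷-< as a<j)) (n≤1+n _)
... | no a≮j = ≤-reflexive (sym (below-∷-≮ as a≮j))

below-mono : ∀ {m j j′} (as : Vec ℕ m) → j ≤ j′ → below as j ≤ below as j′
below-mono [] j≤j′ = z≤n
below-mono {j = j} {j′} (a ∷ as) j≤j′ with a <? j | a <? j′
... | yes a<j | _ rewrite below-∷-< as a<j | below-∷-< as (<-≤-trans a<j j≤j′) =
  s≤s (below-mono as j≤j′)
... | no a≮j | yes a<j′ rewrite below-∷-≮ as a≮j | below-∷-< as a<j′ =
  m≤n⇒m≤1+n (below-mono as j≤j′)
... | no a≮j | no a≮j′ rewrite below-∷-≮ as a≮j | below-∷-≮ as a≮j′ = below-mono as j≤j′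

below-suc : ∀ {m} (as : Vec ℕ m) j → below as (suc j) ≡ mult as j + below as j
below-suc [] j = refl
below-suc (a ∷ as) j with <-cmp a j
... | tri< a<j a≢j _
  rewrite below-∷-< as (m<n⇒m<1+n a<j) | count-∷-no (_≟ j) as a≢j | below-∷-< as a<j =
  trans (cong suc (below-suc as j)) (sym (+-suc _ _))
... | tri≈ _ refl _
  rewrite below-∷-< as (n<1+n a) | count-∷-yes (_≟ a) as refl | below-∷-≮ as (n≮n a) =
  cong suc (below-suc as a)
... | tri> _ a≢j j<a
  rewrite below-∷-≮ as (<⇒≱ j<a ∘ ≤-pred) | count-∷-no (_≟ j) as a≢j | below-∷-≮ as (<⇒≯ j<a) =
  below-suc as j

sum-mult+below≤ : ∀ {m} (as : Vec ℕ m) M j (f : ℕ → ℕ) → (∀ i → f i ≡ mult as (j + i)) →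
                  sum (applyUpTo f M) + below as j ≤ m
sum-mult+below≤ as zero j f f≗ = count≤n (_<? j) as
sum-mult+below≤ {m} as (suc M) j f f≗ = begin
  f 0 + sum (applyUpTo (f ∘ suc) M) + below as j
    ≡⟨ cong (λ x → x + _ + below as j) (trans (f≗ 0) (cong (mult as) (+-identityʳ j))) ⟩
  mult as j + sum (applyUpTo (f ∘ suc) M) + below as j
    ≡⟨ xy∙z≈y∙xz (mult as j) _ (below as j) ⟩
  sum (applyUpTo (f ∘ suc) M) + (mult as j + below as j)
    ≡⟨ cong (sum (applyUpTo (f ∘ suc) M) +_) (below-suc as j) ⟨
  sum (applyUpTo (f ∘ suc) M) + below as (suc j)
    ≤⟨ sum-mult+below≤ as M (suc j) (f ∘ suc) (λ i → trans (f≗ (suc i)) (cong (mult as) (+-suc j i))) ⟩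
  m ∎
  where open ≤-Reasoning

1≤m-n⇒n<m : ∀ {m n} → ℤ.+ 1 ℤ.≤ ℤ.+ m ℤ.- ℤ.+ n → n < m
1≤m-n⇒n<m {m} {n} 1≤m-n with n <? m
... | yes n<m = n<m
... | no n≮m with +≤+ () ← ℤ.≤-trans 1≤m-n (ℤ.i≤j⇒i-j≤0 (+≤+ (≮⇒≥ n≮m)))

complete⇒below≤ : ∀ {n} {α : Vec ℕ n} → IsComplete n α → ∀ j → 2 ≤ j → j ≤ n → 2 + below α j ≤ j
complete⇒below≤ {n} {α} complete j 2≤j j≤n = +-cancelˡ-≤ n _ _ (begin
  n + (2 + below α j)     ≡⟨ trans (+-suc n _) (cong suc (+-suc n _)) ⟩
  suc (suc n) + below α j ≡⟨ cong (λ x → suc x + below α j) M+j≡1+n ⟨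
  suc (M + j) + below α j ≡⟨ cong suc (xy∙z≈xz∙y M j (below α j)) ⟩
  suc M + below α j + j   ≤⟨ +-monoˡ-≤ j 1+M+below≤n ⟩
  n + j                   ∎)
  where
  open ≤-Reasoning
  M = suc n ∸ j
  M+j≡1+n : M + j ≡ suc n
  M+j≡1+n = m∸n+n≡m (m≤n⇒m≤1+n j≤n)
  f : ℕ → ℕ
  f i = mult α (j + i)
  M<S : M < sum (map f (upTo M))
  M<S = 1≤m-n⇒n<m (Equivalence.from (complete j (<⇒≤ 2≤j) j≤n) 2≤j)
  1+M+below≤n : suc M + below α j ≤ n
  1+M+below≤n = ≤-trans (+-monoˡ-≤ (below α j) (subst (λ xs → M < sum xs) (map-upTo f M) M<S))
                        (sum-mult+below≤ α M j f (λ _ → refl))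

overshoot-arith : ∀ {y z Oy Oz C T} → Oy + z ≡ y + Oz → Oy + suc C ≡ T → 2 + T ≤ suc y →
                  z ≤ Oz + C → ⊥
overshoot-arith {y} {z} {Oy} {Oz} {C} {T} occ bal sparse z≤Oz+C = <-irrefl refl (begin-strict
  y + z          ≤⟨ +-monoʳ-≤ y z≤Oz+C ⟩
  y + (Oz + C)   ≡⟨ +-assoc y Oz C ⟨
  y + Oz + C     ≡⟨ cong (_+ C) occ ⟨
  Oy + z + C     ≡⟨ xy∙z≈xz∙y Oy z C ⟩
  Oy + C + z     <⟨ +-monoˡ-< z (+-monoʳ-< Oy (n<1+n C)) ⟩
  Oy + suc C + z ≡⟨ cong (_+ z) bal ⟩
  T + z          <⟨ +-monoˡ-< z (≤-pred sparse) ⟩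
  y + z          ∎)
  where open ≤-Reasoning

-- The searches of the parking rule

backSearch-just : ∀ o s d {r} → backSearch o s d ≡ just r →
                  Free o r × 1 ≤ r × r ≤ s × s < r + d × (∀ p → r < p → p ≤ s → Taken o p)
backSearch-just o (suc s) (suc d) eq with isFree o (suc s) in s-free
backSearch-just o (suc s) (suc d) refl | true =
  s-free , s≤s z≤n , ≤-refl , m<m+n (suc s) z<s , λ p s<p p≤s → contradiction p≤s (<⇒≱ s<p)
... | false with r-free , 1≤r , r≤s , s<r+d , taken ← backSearch-just o s d eq =
  r-free , 1≤r , m≤n⇒m≤1+n r≤s , subst (suc s <_) (sym (+-suc _ d)) (s≤s s<r+d) ,
  taken-interval-suc o s-free taken

backSearch-nothing : ∀ o s d → backSearch o s d ≡ nothing →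
                     ∀ p → 1 ≤ p → p ≤ s → s < p + d → Taken o p
backSearch-nothing o s zero eq p 1≤p p≤s s<p+0 =
  contradiction (subst (s <_) (+-identityʳ p) s<p+0) (≤⇒≯ p≤s)
backSearch-nothing o zero (suc d) eq (suc p) 1≤p ()
backSearch-nothing o (suc s) (suc d) eq p 1≤p p≤1+s 1+s<p+1+d with isFree o (suc s) in s-free
backSearch-nothing o (suc s) (suc d) () p 1≤p p≤1+s 1+s<p+1+d | true
... | false with m≤n⇒m<n∨m≡n p≤1+s
...   | inj₂ refl = s-free
...   | inj₁ p<1+s =
  backSearch-nothing o s d eq p 1≤p (≤-pred p<1+s) (≤-pred (subst (suc s <_) (+-suc p d) 1+s<p+1+d))

fwdSearch-just : ∀ o j f {r} → fwdSearch o j f ≡ just r →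
                 Free o r × j ≤ r × r < j + f × (∀ p → j ≤ p → p < r → Taken o p)
fwdSearch-just o j (suc f) {r} eq with isFree o j in j-free
fwdSearch-just o j (suc f) {.j} refl | true =
  j-free , ≤-refl , m<m+n j z<s , λ p j≤p p<j → contradiction p<j (≤⇒≯ j≤p)
... | false with r-free , j<r , r<1+j+f , taken ← fwdSearch-just o (suc j) f eq =
  r-free , <⇒≤ j<r , subst (r <_) (sym (+-suc j f)) r<1+j+f , taken′
  where
  taken′ : ∀ p → j ≤ p → p < r → Taken o p
  taken′ p j≤p p<r with m≤n⇒m<n∨m≡n j≤p
  ... | inj₁ j<p = taken p j<p p<r
  ... | inj₂ refl = j-free

-- Runs of the k-Naples rule

module Naples (n k : ℕ) where

  Backward Forward : Occ → ℕ → ℕ → Set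
  Backward o a s = s ≤ a × (∀ p → s < p → p ≤ a → Taken o p)
  Forward o a s = a < s × (∀ p → 1 ≤ p → a ≤ p + k → p < s → Taken o p)

  record Parking (o : Occ) (a s : ℕ) : Set where
    field
      free  : Free o s
      1≤s   : 1 ≤ s
      s≤n   : s ≤ n
      a≤s+k : a ≤ s + k
      move  : Backward o a s ⊎ Forward o a s

  parkOne-parking : ∀ o {a s} → 1 ≤ a → a ≤ n → parkOne n k o a ≡ just s → Parking o a s
  parkOne-parking o {suc a} 1≤a a≤n eq with isFree o (suc a) in a-free
  parkOne-parking o {suc a} 1≤a a≤n refl | true = record
    { free = a-free ; 1≤s = 1≤a ; s≤n = a≤n ; a≤s+k = m≤m+n (suc a) k
    ; move = inj₁ (≤-refl , λ p a<p p≤a → contradiction p≤a (<⇒≱ a<p)) }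
  ... | false with backSearch o a k in back
  parkOne-parking o {suc a} 1≤a a≤n refl | false | just r
    with r-free , 1≤r , r≤a , a<r+k , taken ← backSearch-just o a k back = record
    { free = r-free ; 1≤s = 1≤r ; s≤n = ≤-trans (m≤n⇒m≤1+n r≤a) a≤n ; a≤s+k = a<r+k
    ; move = inj₁ (m≤n⇒m≤1+n r≤a , taken-interval-suc o a-free taken) }
  parkOne-parking o {suc a} 1≤a a≤n eq | false | nothing
    with fwdSearch o (suc (suc a)) (n ∸ suc a) in fwd
  parkOne-parking o {suc a} 1≤a a≤n refl | false | nothing | just r
    with r-free , a<r , r<2+a+[n∸1+a] , taken ← fwdSearch-just o (suc (suc a)) (n ∸ suc a) fwd = record
    { free = r-free ; 1≤s = ≤-trans 1≤a (<⇒≤ a<r)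
    ; s≤n = ≤-pred (subst (r <_) (cong suc (m+[n∸m]≡n a≤n)) r<2+a+[n∸1+a])
    ; a≤s+k = ≤-trans (<⇒≤ a<r) (m≤m+n r k)
    ; move = inj₂ (a<r , taken′) }
    where
    taken′ : ∀ p → 1 ≤ p → suc a ≤ p + k → p < r → Taken o p
    taken′ p 1≤p a≤p+k p<r with <-cmp p (suc a)
    ... | tri< p<a _ _ = backSearch-nothing o a k back p 1≤p (≤-pred p<a) a≤p+k
    ... | tri≈ _ refl _ = a-free
    ... | tri> _ _ a<p = taken p a<p p<r

  finalOcc : ∀ {m} → Occ → Vec ℕ m → Occ
  finalOcc o [] = o
  finalOcc o (a ∷ as) = finalOcc (maybe (_∷ o) o (parkOne n k o a)) as

  InStreet : ℕ → Set
  InStreet a = 1 ≤ a × a ≤ n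

  Parks : Maybe ℕ → Set
  Parks r = Σ ℕ λ s → r ≡ just s

  ParksBy : Maybe ℕ → ℕ → Set
  ParksBy r a = Σ ℕ λ s → r ≡ just s × s ≤ a

  AllTaken : Occ → Set
  AllTaken o = ∀ p → 1 ≤ p → p ≤ n → Taken o p

  taken-finalOcc : ∀ {m p} o (as : Vec ℕ m) → Taken o p → Taken (finalOcc o as) p
  taken-finalOcc o [] taken = taken
  taken-finalOcc o (a ∷ as) taken with parkOne n k o a
  ... | just s = taken-finalOcc (s ∷ o) as (taken-∷ o taken)
  ... | nothing = taken-finalOcc o as taken

  parked⇒taken-finalOcc : ∀ {m p} o (as : Vec ℕ m) i → lookup (parkAll n k o as) i ≡ just p →
                          Taken (finalOcc o as) p
  parked⇒taken-finalOcc o (a ∷ as) Fin.zero eq with parkOne n k o a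
  parked⇒taken-finalOcc o (a ∷ as) Fin.zero refl | just s = taken-finalOcc (s ∷ o) as (taken-∷-self o)
  parked⇒taken-finalOcc o (a ∷ as) (Fin.suc i) eq with parkOne n k o a
  ... | just s = parked⇒taken-finalOcc (s ∷ o) as i eq
  ... | nothing = parked⇒taken-finalOcc o as i eq

  taken-finalOcc⇒parked : ∀ {m p} o (as : Vec ℕ m) → Free o p → Taken (finalOcc o as) p →
                          Σ (Fin m) λ i → lookup (parkAll n k o as) i ≡ just p
  taken-finalOcc⇒parked o [] free taken = contradiction taken (free⇒¬taken free)
  taken-finalOcc⇒parked {p = p} o (a ∷ as) free taken with parkOne n k o a
  ... | nothing with i , eq ← taken-finalOcc⇒parked o as free taken = Fin.suc i , eq
  ... | just s with s ≟ p
  ...   | yes refl = Fin.zero , refl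
  ...   | no s≢p with i , eq ← taken-finalOcc⇒parked (s ∷ o) as (trans (isFree-∷-≢ o s≢p) free) taken =
    Fin.suc i , eq

  failures : ∀ {m} → Vec (Maybe ℕ) m → ℕ
  failures [] = 0
  failures (just _ ∷ v) = failures v
  failures (nothing ∷ v) = suc (failures v)

  allParks⇒failures≡0 : ∀ {m} {v : Vec (Maybe ℕ) m} → All Parks v → failures v ≡ 0
  allParks⇒failures≡0 [] = refl
  allParks⇒failures≡0 ((_ , refl) ∷ parks) = allParks⇒failures≡0 parks

  failures≡0⇒allParks : ∀ {m} (v : Vec (Maybe ℕ) m) → failures v ≡ 0 → All Parks v
  failures≡0⇒allParks [] _ = []
  failures≡0⇒allParks (just s ∷ v) eq = (s , refl) ∷ failures≡0⇒allParks v eq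

  occupied-finalOcc : ∀ {m} o (as : Vec ℕ m) → All InStreet as →
                      occupied (finalOcc o as) n + failures (parkAll n k o as) ≡ occupied o n + m
  occupied-finalOcc o [] [] = refl
  occupied-finalOcc {suc m} o (a ∷ as) ((1≤a , a≤n) ∷ in-street) with parkOne n k o a in eq
  ... | just s = let open Parking (parkOne-parking o 1≤a a≤n eq) in begin
    occupied (finalOcc (s ∷ o) as) n + failures (parkAll n k (s ∷ o) as)
      ≡⟨ occupied-finalOcc (s ∷ o) as in-street ⟩
    occupied (s ∷ o) n + m ≡⟨ cong (_+ m) (occupied-∷-free o n free 1≤s s≤n) ⟩
    suc (occupied o n) + m ≡⟨ +-suc _ m ⟨
    occupied o n + suc m   ∎
    where open ≡-Reasoning
  ... | nothing = begin
    occupied (finalOcc o as) n + suc (failures (parkAll n k o as))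
      ≡⟨ +-suc _ _ ⟩
    suc (occupied (finalOcc o as) n + failures (parkAll n k o as))
      ≡⟨ cong suc (occupied-finalOcc o as in-street) ⟩
    suc (occupied o n + m) ≡⟨ +-suc _ m ⟨
    occupied o n + suc m   ∎
    where open ≡-Reasoning

  allParks⇔allTaken : (α : Vec ℕ n) → All InStreet α →
                      All Parks (parkAll n k [] α) ⇔ AllTaken (finalOcc [] α)
  allParks⇔allTaken α in-street = mk⇔
    (λ parks → occupied≡⇒taken fin n (begin
      occupied fin n            ≡⟨ +-identityʳ _ ⟨
      occupied fin n + 0        ≡⟨ cong (occupied fin n +_) (allParks⇒failures≡0 parks) ⟨
      occupied fin n + failed   ≡⟨ spots+failures ⟩
      n                         ∎))
    (λ full → failures≡0⇒allParks _ (+-cancelˡ-≡ n _ 0 (begin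
      n + failed                ≡⟨ cong (_+ failed) (taken⇒occupied≡ fin n full) ⟨
      occupied fin n + failed   ≡⟨ spots+failures ⟩
      n                         ≡⟨ +-identityʳ n ⟨
      n + 0                     ∎)))
    where
    open ≡-Reasoning
    fin = finalOcc [] α
    failed = failures (parkAll n k [] α)
    spots+failures : occupied fin n + failed ≡ n
    spots+failures = trans (occupied-finalOcc [] α in-street) (cong (_+ n) (occupied-[] n))

  allTaken⇒filled : (α : Vec ℕ n) → AllTaken (finalOcc [] α) →
                    (j : Fin n) → Σ (Fin n) λ i → lookup (parkAll n k [] α) i ≡ just (suc (toℕ j))
  allTaken⇒filled α full j = taken-finalOcc⇒parked [] α refl (full (suc (toℕ j)) (s≤s z≤n) (toℕ<n j))

  filled⇒allTaken : (α : Vec ℕ n) →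
                    ((j : Fin n) → Σ (Fin n) λ i → lookup (parkAll n k [] α) i ≡ just (suc (toℕ j))) →
                    AllTaken (finalOcc [] α)
  filled⇒allTaken α filled (suc p) _ p<n with i , eq ← filled (fromℕ< p<n) =
    parked⇒taken-finalOcc [] α i (trans eq (cong (just ∘ suc) (toℕ-fromℕ< p<n)))

  -- A car preferring a spot beyond z + k never parks in [1, z].
  occupied-finalOcc-≤ : ∀ {m} o (as : Vec ℕ m) z → All InStreet as →
                        occupied (finalOcc o as) z ≤ occupied o z + below as (suc (z + k))
  occupied-finalOcc-≤ o [] z [] = m≤m+n _ 0
  occupied-finalOcc-≤ o (a ∷ as) z ((1≤a , a≤n) ∷ in-street) with parkOne n k o a in eq
  ... | nothing =
    ≤-trans (occupied-finalOcc-≤ o as z in-street) (+-monoʳ-≤ _ (below≤below-∷ a as _))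
  ... | just s with a <? suc (z + k)
  ...   | yes a≤z+k = begin
    occupied (finalOcc (s ∷ o) as) z            ≤⟨ occupied-finalOcc-≤ (s ∷ o) as z in-street ⟩
    occupied (s ∷ o) z + below as (suc (z + k)) ≤⟨ +-monoˡ-≤ _ (occupied-∷-≤ o z) ⟩
    suc (occupied o z) + below as (suc (z + k)) ≡⟨ +-suc _ _ ⟨
    occupied o z + suc (below as (suc (z + k))) ≡⟨ cong (occupied o z +_) (below-∷-< as a≤z+k) ⟨
    occupied o z + below (a ∷ as) (suc (z + k)) ∎
    where open ≤-Reasoning
  ...   | no a>z+k = begin
    occupied (finalOcc (s ∷ o) as) z            ≤⟨ occupied-finalOcc-≤ (s ∷ o) as z in-street ⟩
    occupied (s ∷ o) z + below as (suc (z + k)) ≡⟨ cong (_+ _) (occupied-∷-> o z z<park) ⟩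
    occupied o z + below as (suc (z + k))       ≡⟨ cong (occupied o z +_) (below-∷-≮ as a>z+k) ⟨
    occupied o z + below (a ∷ as) (suc (z + k)) ∎
    where
    open ≤-Reasoning
    z<park : z < s
    z<park = +-cancelʳ-< k z s
      (<-≤-trans (≰⇒> (a>z+k ∘ s≤s)) (Parking.a≤s+k (parkOne-parking o 1≤a a≤n eq)))

  module Complete (α : Vec ℕ n) (sparse : ∀ j → 2 ≤ j → j ≤ n → 2 + below α j ≤ j) where

    -- No parked car has crossed a free spot y + 1: the cars of α preferring spots ≤ y
    -- are the ones parked in [1, y] together with those still to come in as.
    Balanced : ∀ {m} → Occ → Vec ℕ m → Set
    Balanced o as = ∀ y → y < n → Free o (suc y) → occupied o y + below as (suc y) ≡ below α (suc y)

    balanced-[] : Balanced [] α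
    balanced-[] y _ _ = cong (_+ below α (suc y)) (occupied-[] y)

    balanced-∷ : ∀ {m} o {a s} (as : Vec ℕ m) → Free o s → 1 ≤ s → Backward o a s →
                 Balanced o (a ∷ as) → Balanced (s ∷ o) as
    balanced-∷ o {a} {s} as s-free 1≤s (s≤a , taken) bal y y<n y-free′ with a <? suc y
    ... | yes a≤y = begin
      occupied (s ∷ o) y + below as (suc y)
        ≡⟨ cong (_+ below as (suc y)) (occupied-∷-free o y s-free 1≤s (≤-trans s≤a (≤-pred a≤y))) ⟩
      suc (occupied o y) + below as (suc y) ≡⟨ +-suc _ _ ⟨
      occupied o y + suc (below as (suc y)) ≡⟨ cong (occupied o y +_) (below-∷-< as a≤y) ⟨
      occupied o y + below (a ∷ as) (suc y) ≡⟨ bal y y<n (free-∷⁻ o y-free′) ⟩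
      below α (suc y)                       ∎
      where open ≡-Reasoning
    ... | no a>y = begin
      occupied (s ∷ o) y + below as (suc y) ≡⟨ cong (_+ below as (suc y)) (occupied-∷-> o y y<s) ⟩
      occupied o y + below as (suc y)       ≡⟨ cong (occupied o y +_) (below-∷-≮ as a>y) ⟨
      occupied o y + below (a ∷ as) (suc y) ≡⟨ bal y y<n y-free ⟩
      below α (suc y)                       ∎
      where
      open ≡-Reasoning
      y-free = free-∷⁻ o y-free′
      y<s : y < s
      y<s = ≰⇒> (λ s≤y → free⇒¬taken y-free (taken (suc y) (s≤s s≤y) (≮⇒≥ a>y)))

    no-overshoot : ∀ {m} o {a s} (as : Vec ℕ m) → All InStreet as → Balanced o (a ∷ as) → 1 ≤ a →
                   Free o s → s ≤ n → Forward o a s → AllTaken (finalOcc (s ∷ o) as) → ⊥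
    no-overshoot o {a} {suc y} as in-street bal 1≤a s-free s≤n (a<s , taken) full
      with z , z≤y , z-free-or-0 , occ-y ← lastFree o y =
      overshoot-arith occ-y bal-y (sparse (suc y) (≤-trans (s≤s 1≤a) a<s) s≤n) (deficit z-free-or-0)
      where
      C = below as (suc y)
      bal-y : occupied o y + suc C ≡ below α (suc y)
      bal-y = trans (cong (occupied o y +_) (sym (below-∷-< as a<s))) (bal y s≤n s-free)
      fin = finalOcc (suc y ∷ o) as
      deficit : z ≡ 0 ⊎ (1 ≤ z × Free o z) → z ≤ occupied o z + C
      deficit (inj₁ z≡0) = subst (_≤ occupied o z + C) (sym z≡0) z≤n
      deficit (inj₂ (1≤z , z-free)) = begin
        z                                               ≡⟨ taken⇒occupied≡ fin z full-z ⟨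
        occupied fin z                                  ≤⟨ occupied-finalOcc-≤ (suc y ∷ o) as z in-street ⟩
        occupied (suc y ∷ o) z + below as (suc (z + k)) ≡⟨ cong (_+ _) (occupied-∷-> o z (s≤s z≤y)) ⟩
        occupied o z + below as (suc (z + k))           ≤⟨ +-monoʳ-≤ _ (below-mono as z+k<y+1) ⟩
        occupied o z + C                                ∎
        where
        open ≤-Reasoning
        full-z : ∀ p → 1 ≤ p → p ≤ z → Taken fin p
        full-z p 1≤p p≤z = full p 1≤p (≤-trans p≤z (≤-trans z≤y (<⇒≤ s≤n)))
        z+k<a : z + k < a
        z+k<a = ≰⇒> (λ a≤z+k → free⇒¬taken z-free (taken z 1≤z a≤z+k (s≤s z≤y)))
        z+k<y+1 : suc (z + k) ≤ suc y
        z+k<y+1 = ≤-trans z+k<a (<⇒≤ a<s)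

    park≤pref : ∀ {m} o (as : Vec ℕ m) → All InStreet as → Balanced o as → AllTaken (finalOcc o as) →
                All Parks (parkAll n k o as) → Pointwise ParksBy (parkAll n k o as) as
    park≤pref o [] [] _ _ [] = []
    park≤pref o (a ∷ as) ((1≤a , a≤n) ∷ in-street) bal full parks with parkOne n k o a in eq
    park≤pref o (a ∷ as) _ _ _ ((_ , ()) ∷ _) | nothing
    park≤pref o (a ∷ as) ((1≤a , a≤n) ∷ in-street) bal full (_ ∷ parks) | just s
      with record { free = s-free ; 1≤s = 1≤s ; s≤n = s≤n ; move = move } ← parkOne-parking o 1≤a a≤n eq
      with move
    ... | inj₁ backward@(s≤a , _) =
      (s , refl , s≤a) ∷ park≤pref (s ∷ o) as in-street (balanced-∷ o as s-free 1≤s backward bal) full parks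
    ... | inj₂ forward = ⊥-elim (no-overshoot o as in-street bal 1≤a s-free s≤n forward full)

mainTheorem3 : (n k : ℕ) → 2 ≤ n → 1 ≤ k → (α : Vec ℕ n) → IsPP n α → IsComplete n α →
    (IsPF n k α ⇔ ((j : Fin n) → Σ (Fin n) (λ i → (ψ n k α i ≡ just (suc (toℕ j))) × (suc (toℕ j) ≤ lookup α i))))
    × (IsPF n k α ⇔ ((j : Fin n) → Σ ℕ (λ s → (ψ n k α j ≡ just s) × (s ≤ lookup α j))))
mainTheorem3 n k _ _ α pp complete = mk⇔ pf⇒filled filled⇒pf , mk⇔ pf⇒park≤pref park≤pref⇒pf
  where
  open Naples n k
  open Complete α (complete⇒below≤ {α = α} complete)
  allParks⇔ = allParks⇔allTaken α (lookup⁻ pp)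

  pf⇒allTaken : IsPF n k α → AllTaken (finalOcc [] α)
  pf⇒allTaken pf = Equivalence.to allParks⇔ (lookup⁻ pf)

  pf⇒park≤pref : IsPF n k α → (j : Fin n) → ParksBy (ψ n k α j) (lookup α j)
  pf⇒park≤pref pf = Pointwise.lookup (park≤pref [] α (lookup⁻ pp) balanced-[] (pf⇒allTaken pf) (lookup⁻ pf))

  park≤pref⇒pf : ((j : Fin n) → ParksBy (ψ n k α j) (lookup α j)) → IsPF n k α
  park≤pref⇒pf parks j = proj₁ (parks j) , proj₁ (proj₂ (parks j))

  pf⇒filled : IsPF n k α → (j : Fin n) → Σ (Fin n) λ i → ψ n k α i ≡ just (suc (toℕ j)) × suc (toℕ j) ≤ lookup α i
  pf⇒filled pf j with i , eq ← allTaken⇒filled α (pf⇒allTaken pf) j with s , eq′ , s≤a ← pf⇒park≤pref pf i =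
    i , eq , subst (_≤ lookup α i) (just-injective (trans (sym eq′) eq)) s≤a

  filled⇒pf : ((j : Fin n) → Σ (Fin n) λ i → ψ n k α i ≡ just (suc (toℕ j)) × suc (toℕ j) ≤ lookup α i) →
              IsPF n k α
  filled⇒pf filled =
    lookup⁺ (Equivalence.from allParks⇔ (filled⇒allTaken α λ j → proj₁ (filled j) , proj₁ (proj₂ (filled j))))
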